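{- Let $d$ be sufficiently large and let $H \subseteq \{0,1\}^d$ be a hidden set with $|H| = n \le 2^{o(d/\log d)}$. Let $t = 2^{O(\sqrt{d\cdot\log d\cdot \log n})}$ and $r = O(\sqrt{(d\log n)/\log d})$ be as in the algorithm below (with suitably chosen constants). Query $t$ points $\mathbf{y}_1,\dots,\mathbf{y}_t$ sampled independently and uniformly at random from $\{0,1\}^d$, and let $\mathbf{z}_i \in H$ be the answer to query $\mathbf{y}_i$. Fix a point $\mathbf{x} \in H$ and let $\mathbf{z}$ be the point among $\mathbf{z}_1,\dots,\mathbf{z}_t$ nearest to $\mathbf{x}$ in Hamming distance. Then with probability at least $1 - 1/(3n)$, the Hamming distance between $\mathbf{x}$ and $\mathbf{z}$ is at most $r$.
   Context: Problem setting: an unknown (hidden) set $H$ of $n$ points in $\{0,1\}^d$. Querying a point $\mathbf{q} \in \{0,1\}^d$ returns a point of $H$ having the smallest Hamming distance to $\mathbf{q}$ (ties broken by some fixed rule). The Hamming distance between two points is the number of coordinates in which they differ. The algorithm in question: first round queries $t$ uniformly random points; second round queries all points within Hamming distance $r$ of each answer from the first round. -}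

module Defs where

open import Data.Nat using (ℕ; zero; suc; _+_; _*_; _<ᵇ_)
open import Data.Bool using (Bool; true; false; _∧_; if_then_else_)
open import Data.List using (List; []; _∷_; concatMap; map)
open import Data.Vec using (Vec; []; _∷_; lookup)
open import Data.Fin using (Fin)

Point : ℕ → Set
Point d = Vec Bool d

hamming : ∀ {d} → Point d → Point d → ℕ
hamming []       []       = 0
hamming (a ∷ u) (b ∷ v) = (if eqB a b then 0 else 1) + hamming u v
  where
  eqB : Bool → Bool → Bool
  eqB true  true  = true
  eqB false false = true
  eqB _     _     = false

tuples : ∀ {A : Set} (k : ℕ) → List A → List (Vec A k)
tuples zero    xs = [] ∷ []
tuples (suc k) xs = concatMap (λ a → map (a ∷_) (tuples k xs)) xs

allPoints : (d : ℕ) → List (Point d)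
allPoints d = tuples d (false ∷ true ∷ [])

count : ∀ {A : Set} → (A → Bool) → List A → ℕ
count p []       = 0
count p (x ∷ xs) = (if p x then 1 else 0) + count p xs

-- A nearest-neighbour oracle for the hidden set H = {H 0, ..., H (n-1)}:
-- it returns (the index of) a point of H of minimal Hamming distance to the
-- query; ties are broken by whatever fixed rule the function encodes.
IsNNOracle : ∀ {d n} → Vec (Point d) n → (Point d → Fin n) → Set
IsNNOracle {d} {n} H ans =
  (q : Point d) (j : Fin n) → hamming q (lookup H (ans q)) Data.Nat.≤ hamming q (lookup H j)

-- A first-round sample ys = (y_1,...,y_t) is "bad" for x (given the radius r)
-- when every answer z_i = ans y_i is at distance > r from x, i.e. the nearest
-- z among z_1..z_t is at distance > r from x.
badSample : ∀ {d n t} → Vec (Point d) n → (Point d → Fin n) → Point d → ℕ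
          → Vec (Point d) t → Bool
badSample H ans x r []       = true
badSample H ans x r (y ∷ ys) = (r <ᵇ hamming x (lookup H (ans y))) ∧ badSample H ans x r ys

-- Fix x ∈ H and weight each y ∈ {0,1}^d by (M+1)^(#agreements with x) (M-1)^(#disagreements),
-- a product measure tilted towards x, of total mass (2M)^d.  If the answer w to the query y lies at
-- distance > r from x, then y is at least as close to w as to x.  For a fixed w at distance at least
-- 2M²j from x, exponential tilting (a Chernoff bound) shows that such y carry at most a 2^-j fraction
-- of the tilted mass; with j = L + 2 and a union bound over the n ≤ 2^L points of H, the bad queries
-- carry at most a quarter of it.  Cauchy–Schwarz then turns the remaining mass into a count: the good
-- queries number G with (2M)^(2d) ≤ 4 G (2(1 + M²))^d, hence G ≥ 2^(d-q-2) once (1 + 1/M²)^d ≤ 2^q.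
-- So 2^(q+2) uniform queries all miss the good set with probability at most 1/2, and 2^(q+2) 2^(L+2)
-- of them with probability at most 2^-2^(L+2) ≤ 1/(3n).  Choosing M ≈ (d / (log d log n))^(1/4)
-- makes k = O(√(d log d log n)) and r = O(√(d log n / log d)).

module Submission where

open import Defs
open import Data.Bool using (Bool; true; false; if_then_else_; _∧_; not; T)
open import Data.Bool.Properties using (T-≡)
open import Data.Fin using (Fin)
import Data.Fin as Fin
open import Data.List using (List; []; _∷_; _++_; map; concatMap; length; allFin)
open import Data.List.Membership.Propositional using (_∈_)
open import Data.List.Membership.Propositional.Properties using (∈-allFin)
open import Data.List.Properties using (length-tabulate)
open import Data.List.Relation.Unary.Any using (here; there)
open import Data.Nat
open import Data.Nat.Induction using (<-wellFounded)
open import Data.Nat.Logarithm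
open import Data.Nat.Logarithm.Core using (⌈log2⌉)
open import Data.Nat.Properties
open import Algebra.Properties.CommutativeSemigroup +-commutativeSemigroup
  using () renaming (interchange to +-interchange)
open import Algebra.Properties.CommutativeSemigroup *-commutativeSemigroup
  using () renaming (interchange to *-interchange; xy∙z≈xz∙y to x*y*z≡x*z*y; xy∙z≈zy∙x to x*y*z≡z*y*x)
open import Data.Nat.Tactic.RingSolver using (solve-∀)
open import Data.Product using (∃-syntax; _×_; _,_)
open import Data.Sum using (inj₁; inj₂)
open import Data.Vec using (Vec; []; _∷_; lookup)
import Data.Vec
open import Function using (_∘_; id)
open import Function.Bundles using (Equivalence)
open import Function.Definitions using (Injective)
open import Induction.WellFounded using (Acc; acc)
open import Relation.Binary.PropositionalEquality
open import Relation.Nullary using (yes; no; contradiction)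

private variable
  X Y : Set

-- Finite sums

𝟙 : Bool → ℕ
𝟙 b = if b then 1 else 0

∑ : List X → (X → ℕ) → ℕ
∑ []       f = 0
∑ (x ∷ xs) f = f x + ∑ xs f

syntax ∑ xs (λ x → e) = ∑[ x ∈ xs ] e

𝟙-∧ : ∀ a b → 𝟙 (a ∧ b) ≡ 𝟙 a * 𝟙 b
𝟙-∧ true  b = sym (+-identityʳ (𝟙 b))
𝟙-∧ false b = refl

𝟙*𝟙 : ∀ b → 𝟙 b * 𝟙 b ≡ 𝟙 b
𝟙*𝟙 true  = refl
𝟙*𝟙 false = refl

𝟙*≤ : ∀ b t → 𝟙 b * t ≤ t
𝟙*≤ true  t = ≤-reflexive (*-identityˡ t)
𝟙*≤ false t = z≤n

𝟙-not-+ : ∀ b t → 𝟙 (not b) * t + 𝟙 b * t ≡ t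
𝟙-not-+ true  t = *-identityˡ t
𝟙-not-+ false t = trans (+-identityʳ _) (*-identityˡ t)

count≡∑𝟙 : (p : X → Bool) (xs : List X) → count p xs ≡ ∑ xs (𝟙 ∘ p)
count≡∑𝟙 p []       = refl
count≡∑𝟙 p (x ∷ xs) = cong (𝟙 (p x) +_) (count≡∑𝟙 p xs)

count-none : (p : X → Bool) (xs : List X) → (∀ x → p x ≡ false) → count p xs ≡ 0
count-none p []       none = refl
count-none p (x ∷ xs) none rewrite none x = count-none p xs none

∑-++ : (xs ys : List X) (f : X → ℕ) → ∑ (xs ++ ys) f ≡ ∑ xs f + ∑ ys f
∑-++ []       ys f = refl
∑-++ (x ∷ xs) ys f = trans (cong (f x +_) (∑-++ xs ys f)) (sym (+-assoc (f x) _ _))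

∑-map : (g : Y → X) (xs : List Y) (f : X → ℕ) → ∑ (map g xs) f ≡ ∑ xs (f ∘ g)
∑-map g []       f = refl
∑-map g (x ∷ xs) f = cong (f (g x) +_) (∑-map g xs f)

∑-cong : (xs : List X) {f g : X → ℕ} → (∀ x → f x ≡ g x) → ∑ xs f ≡ ∑ xs g
∑-cong []       eq = refl
∑-cong (x ∷ xs) eq = cong₂ _+_ (eq x) (∑-cong xs eq)

∑-mono-≤ : (xs : List X) {f g : X → ℕ} → (∀ x → f x ≤ g x) → ∑ xs f ≤ ∑ xs g
∑-mono-≤ []       le = z≤n
∑-mono-≤ (x ∷ xs) le = +-mono-≤ (le x) (∑-mono-≤ xs le)

∑-+ : (xs : List X) (f g : X → ℕ) → ∑[ x ∈ xs ] (f x + g x) ≡ ∑ xs f + ∑ xs g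
∑-+ []       f g = refl
∑-+ (x ∷ xs) f g = trans (cong (f x + g x +_) (∑-+ xs f g)) (+-interchange (f x) (g x) _ _)

∑-*ˡ : (k : ℕ) (xs : List X) (f : X → ℕ) → ∑[ x ∈ xs ] (k * f x) ≡ k * ∑ xs f
∑-*ˡ k []       f = sym (*-zeroʳ k)
∑-*ˡ k (x ∷ xs) f = trans (cong (k * f x +_) (∑-*ˡ k xs f)) (sym (*-distribˡ-+ k (f x) _))

∑-*ʳ : (k : ℕ) (xs : List X) (f : X → ℕ) → ∑[ x ∈ xs ] (f x * k) ≡ ∑ xs f * k
∑-*ʳ k xs f = trans (∑-cong xs (λ x → *-comm (f x) k)) (trans (∑-*ˡ k xs f) (*-comm k _))

∑-≥-term : (xs : List X) (f : X → ℕ) {x : X} → x ∈ xs → f x ≤ ∑ xs f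
∑-≥-term (y ∷ xs) f (here refl) = m≤m+n (f y) _
∑-≥-term (y ∷ xs) f (there x∈xs) = ≤-trans (∑-≥-term xs f x∈xs) (m≤n+m _ (f y))

∑-≤-length* : (xs : List X) (f : X → ℕ) {b : ℕ} → (∀ x → f x ≤ b) → ∑ xs f ≤ length xs * b
∑-≤-length* []       f le = z≤n
∑-≤-length* (x ∷ xs) f le = +-mono-≤ (le x) (∑-≤-length* xs f le)

∑-swap : (xs : List X) (ys : List Y) (g : X → Y → ℕ) →
         ∑[ x ∈ xs ] ∑[ y ∈ ys ] g x y ≡ ∑[ y ∈ ys ] ∑[ x ∈ xs ] g x y
∑-swap []       ys g = sym (∑-*ˡ 0 ys (λ _ → 0))
∑-swap (x ∷ xs) ys g = trans (cong (∑ ys (g x) +_) (∑-swap xs ys g)) (sym (∑-+ ys (g x) _))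

∑-concatMap : (f : X → List Y) (xs : List X) (g : Y → ℕ) → ∑ (concatMap f xs) g ≡ ∑[ x ∈ xs ] ∑ (f x) g
∑-concatMap f []       g = refl
∑-concatMap f (x ∷ xs) g = trans (∑-++ (f x) (concatMap f xs) g) (cong (∑ (f x) g +_) (∑-concatMap f xs g))

m*m≤n*n⇒m≤n : ∀ m n → m * m ≤ n * n → m ≤ n
m*m≤n*n⇒m≤n m n le with m ≤? n
... | yes m≤n = m≤n
... | no  m≰n = contradiction le (<⇒≱ (*-mono-< (≰⇒> m≰n) (≰⇒> m≰n)))

4*m*n≤[m+n]² : ∀ m n → 4 * (m * n) ≤ (m + n) * (m + n)
4*m*n≤[m+n]² m n with ≤-total m n
... | inj₁ m≤n = subst (λ n → 4 * (m * n) ≤ (m + n) * (m + n)) (m+[n∸m]≡n m≤n)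
                   (≤-trans (m≤m+n _ _) (≤-reflexive (square-gap m (n ∸ m))))
  where
  square-gap : ∀ m t → 4 * (m * (m + t)) + t * t ≡ (m + (m + t)) * (m + (m + t))
  square-gap = solve-∀
... | inj₂ n≤m = subst (λ m → 4 * (m * n) ≤ (m + n) * (m + n)) (m+[n∸m]≡n n≤m)
                   (≤-trans (m≤m+n _ _) (≤-reflexive (square-gap n (m ∸ n))))
  where
  square-gap : ∀ n t → 4 * ((n + t) * n) + t * t ≡ (n + t + n) * (n + t + n)
  square-gap = solve-∀

cauchy-schwarz : (xs : List X) (f g : X → ℕ) →
  ∑[ x ∈ xs ] (f x * g x) * ∑[ x ∈ xs ] (f x * g x) ≤ ∑[ x ∈ xs ] (f x * f x) * ∑[ x ∈ xs ] (g x * g x)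
cauchy-schwarz []       f g = z≤n
cauchy-schwarz (z ∷ xs) f g = begin
  (a * b + sfg) * (a * b + sfg)                              ≡⟨ expandˡ a b sfg ⟩
  a * a * (b * b) + 2 * a * b * sfg + sfg * sfg              ≤⟨ +-mono-≤ (+-monoʳ-≤ (a * a * (b * b)) cross) (cauchy-schwarz xs f g) ⟩
  a * a * (b * b) + (a * a * sgg + b * b * sff) + sff * sgg  ≡⟨ expandʳ a b sff sgg ⟩
  (a * a + sff) * (b * b + sgg)                              ∎
  where
  open ≤-Reasoning
  a b sfg sff sgg : ℕ
  a = f z
  b = g z
  sfg = ∑[ x ∈ xs ] (f x * g x)
  sff = ∑[ x ∈ xs ] (f x * f x)
  sgg = ∑[ x ∈ xs ] (g x * g x)
  cross : 2 * a * b * sfg ≤ a * a * sgg + b * b * sff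
  cross = m*m≤n*n⇒m≤n _ _ (begin
    2 * a * b * sfg * (2 * a * b * sfg)     ≡⟨ regroup a b sfg ⟩
    4 * (a * a * (b * b)) * (sfg * sfg)     ≤⟨ *-monoʳ-≤ (4 * (a * a * (b * b))) (cauchy-schwarz xs f g) ⟩
    4 * (a * a * (b * b)) * (sff * sgg)     ≡⟨ regroup′ a b sff sgg ⟩
    4 * ((a * a * sgg) * (b * b * sff))     ≤⟨ 4*m*n≤[m+n]² (a * a * sgg) (b * b * sff) ⟩
    (a * a * sgg + b * b * sff) * (a * a * sgg + b * b * sff) ∎)
    where
    regroup : ∀ a b sfg → 2 * a * b * sfg * (2 * a * b * sfg) ≡ 4 * (a * a * (b * b)) * (sfg * sfg)
    regroup = solve-∀
    regroup′ : ∀ a b sff sgg → 4 * (a * a * (b * b)) * (sff * sgg) ≡ 4 * ((a * a * sgg) * (b * b * sff))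
    regroup′ = solve-∀
  expandˡ : ∀ a b sfg → (a * b + sfg) * (a * b + sfg) ≡ a * a * (b * b) + 2 * a * b * sfg + sfg * sfg
  expandˡ = solve-∀
  expandʳ : ∀ a b sff sgg → a * a * (b * b) + (a * a * sgg + b * b * sff) + sff * sgg ≡ (a * a + sff) * (b * b + sgg)
  expandʳ = solve-∀

-- Sums over the cube

∑-allPoints-suc : ∀ {d} (f : Point (suc d) → ℕ) →
  ∑ (allPoints (suc d)) f ≡ ∑[ y ∈ allPoints d ] f (false ∷ y) + ∑[ y ∈ allPoints d ] f (true ∷ y)
∑-allPoints-suc {d} f = begin
  ∑ (map (false ∷_) cube ++ (map (true ∷_) cube ++ [])) f     ≡⟨ ∑-++ (map (false ∷_) cube) _ f ⟩
  ∑ (map (false ∷_) cube) f + ∑ (map (true ∷_) cube ++ []) f  ≡⟨ cong (∑ (map (false ∷_) cube) f +_) (trans (∑-++ (map (true ∷_) cube) [] f) (+-identityʳ _)) ⟩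
  ∑ (map (false ∷_) cube) f + ∑ (map (true ∷_) cube) f        ≡⟨ cong₂ _+_ (∑-map (false ∷_) cube f) (∑-map (true ∷_) cube f) ⟩
  ∑[ y ∈ cube ] f (false ∷ y) + ∑[ y ∈ cube ] f (true ∷ y)    ∎
  where
  open ≡-Reasoning
  cube : List (Point d)
  cube = allPoints d

∑-allPoints-1 : ∀ d → ∑[ _ ∈ allPoints d ] 1 ≡ 2 ^ d
∑-allPoints-1 zero    = refl
∑-allPoints-1 (suc d) = begin
  ∑ (allPoints (suc d)) (λ _ → 1)                    ≡⟨ ∑-allPoints-suc {d} (λ _ → 1) ⟩
  ∑ (allPoints d) (λ _ → 1) + ∑ (allPoints d) (λ _ → 1) ≡⟨ cong (λ t → t + t) (∑-allPoints-1 d) ⟩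
  2 ^ d + 2 ^ d                                       ≡⟨ cong (2 ^ d +_) (sym (+-identityʳ _)) ⟩
  2 ^ suc d                                           ∎
  where open ≡-Reasoning

weight : ∀ {d} → Vec (Bool → ℕ) d → Point d → ℕ
weight []       []      = 1
weight (g ∷ gs) (b ∷ y) = g b * weight gs y

totalWeight : ∀ {d} → Vec (Bool → ℕ) d → ℕ
totalWeight []       = 1
totalWeight (g ∷ gs) = (g false + g true) * totalWeight gs

∑-weight : ∀ {d} (gs : Vec (Bool → ℕ) d) → ∑ (allPoints d) (weight gs) ≡ totalWeight gs
∑-weight []       = refl
∑-weight {suc d} (g ∷ gs) = begin
  ∑ (allPoints (suc d)) (weight (g ∷ gs))                         ≡⟨ ∑-allPoints-suc (weight (g ∷ gs)) ⟩
  ∑[ y ∈ allPoints d ] (g false * weight gs y) + ∑[ y ∈ allPoints d ] (g true * weight gs y)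
                                                               ≡⟨ cong₂ _+_ (∑-*ˡ (g false) (allPoints d) (weight gs)) (∑-*ˡ (g true) (allPoints d) (weight gs)) ⟩
  g false * ∑ (allPoints d) (weight gs) + g true * ∑ (allPoints d) (weight gs)
                                                               ≡⟨ sym (*-distribʳ-+ _ (g false) (g true)) ⟩
  (g false + g true) * ∑ (allPoints d) (weight gs)             ≡⟨ cong ((g false + g true) *_) (∑-weight gs) ⟩
  totalWeight (g ∷ gs)                                         ∎
  where open ≡-Reasoning

squareWeights : ∀ {d} → Vec (Bool → ℕ) d → Vec (Bool → ℕ) d
squareWeights = Data.Vec.map (λ g b → g b * g b)

weight-square : ∀ {d} (gs : Vec (Bool → ℕ) d) y → weight gs y * weight gs y ≡ weight (squareWeights gs) y
weight-square []       []      = refl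
weight-square (g ∷ gs) (b ∷ y) = trans (*-interchange (g b) (weight gs y) (g b) (weight gs y))
                                       (cong (g b * g b *_) (weight-square gs y))

module _ {d n} (H : Vec (Point d) n) (ans : Point d → Fin n) (x : Point d) (r : ℕ) where

  answerFar : Point d → Bool
  answerFar y = r <ᵇ hamming x (lookup H (ans y))

  count-badSample-tuples : ∀ t (xs : List (Point d)) →
    count (badSample H ans x r) (tuples t xs) ≡ count answerFar xs ^ t
  count-badSample-tuples zero    xs = refl
  count-badSample-tuples (suc t) xs = begin
    count bad (concatMap (λ a → map (a ∷_) Ts) xs)                 ≡⟨ count≡∑𝟙 bad (concatMap (λ a → map (a ∷_) Ts) xs) ⟩
    ∑ (concatMap (λ a → map (a ∷_) Ts) xs) (𝟙 ∘ bad)               ≡⟨ ∑-concatMap (λ a → map (a ∷_) Ts) xs (𝟙 ∘ bad) ⟩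
    ∑[ a ∈ xs ] ∑ (map (a ∷_) Ts) (𝟙 ∘ bad)                        ≡⟨ ∑-cong xs (λ a → trans (∑-map (a ∷_) Ts (𝟙 ∘ bad))
                                                                        (∑-cong Ts (λ ys → 𝟙-∧ (answerFar a) (bad ys)))) ⟩
    ∑[ a ∈ xs ] ∑[ ys ∈ Ts ] (𝟙 (answerFar a) * 𝟙 (bad ys))       ≡⟨ ∑-cong xs (λ a → ∑-*ˡ (𝟙 (answerFar a)) Ts (𝟙 ∘ bad)) ⟩
    ∑[ a ∈ xs ] (𝟙 (answerFar a) * ∑ Ts (𝟙 ∘ bad))                 ≡⟨ ∑-*ʳ (∑ Ts (𝟙 ∘ bad)) xs (𝟙 ∘ answerFar) ⟩
    ∑ xs (𝟙 ∘ answerFar) * ∑ Ts (𝟙 ∘ bad)                          ≡⟨ sym (cong₂ _*_ (count≡∑𝟙 answerFar xs) (count≡∑𝟙 bad Ts)) ⟩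
    count answerFar xs * count bad Ts                              ≡⟨ cong (count answerFar xs *_) (count-badSample-tuples t xs) ⟩
    count answerFar xs ^ suc t                                    ∎
    where
    open ≡-Reasoning
    bad : ∀ {t} → Vec (Point d) t → Bool
    bad = badSample H ans x r
    Ts : List (Vec (Point d) t)
    Ts = tuples t xs

n≤2⌈n/2⌉ : ∀ n → n ≤ 2 * ⌈ n /2⌉
n≤2⌈n/2⌉ n = begin
  n                    ≡⟨ sym (⌊n/2⌋+⌈n/2⌉≡n n) ⟩
  ⌊ n /2⌋ + ⌈ n /2⌉    ≤⟨ +-monoˡ-≤ ⌈ n /2⌉ (⌊n/2⌋≤⌈n/2⌉ n) ⟩
  ⌈ n /2⌉ + ⌈ n /2⌉    ≡⟨ cong (⌈ n /2⌉ +_) (sym (+-identityʳ _)) ⟩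
  2 * ⌈ n /2⌉          ∎
  where open ≤-Reasoning

2⌈n/2⌉≤1+n : ∀ n → 2 * ⌈ n /2⌉ ≤ suc n
2⌈n/2⌉≤1+n n = begin
  2 * ⌊ suc n /2⌋              ≡⟨ cong (⌊ suc n /2⌋ +_) (+-identityʳ _) ⟩
  ⌊ suc n /2⌋ + ⌊ suc n /2⌋    ≤⟨ +-monoʳ-≤ ⌊ suc n /2⌋ (⌊n/2⌋≤⌈n/2⌉ (suc n)) ⟩
  ⌊ suc n /2⌋ + ⌈ suc n /2⌉    ≡⟨ ⌊n/2⌋+⌈n/2⌉≡n (suc n) ⟩
  suc n                        ∎
  where open ≤-Reasoning

n≤2^⌈log₂n⌉ : ∀ n → n ≤ 2 ^ ⌈log₂ n ⌉
n≤2^⌈log₂n⌉ n = go n (<-wellFounded n)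
  where
  go : ∀ n (acc : Acc _<_ n) → n ≤ 2 ^ ⌈log2⌉ n acc
  go zero          _        = z≤n
  go (suc zero)    _        = s≤s z≤n
  go (suc (suc n)) (acc _)  = begin
    suc (suc n)                    ≤⟨ s≤s (s≤s (n≤2⌈n/2⌉ n)) ⟩
    2 + 2 * ⌈ n /2⌉                ≡⟨ sym (*-distribˡ-+ 2 1 ⌈ n /2⌉) ⟩
    2 * suc ⌈ n /2⌉                ≤⟨ *-monoʳ-≤ 2 (go (suc ⌈ n /2⌉) _) ⟩
    2 * 2 ^ ⌈log2⌉ (suc ⌈ n /2⌉) _ ∎
    where open ≤-Reasoning

⌊log₂n⌋≤⌈log₂n⌉ : ∀ n → ⌊log₂ n ⌋ ≤ ⌈log₂ n ⌉
⌊log₂n⌋≤⌈log₂n⌉ n = ≤-trans (⌊log₂⌋-mono-≤ (n≤2^⌈log₂n⌉ n)) (≤-reflexive (⌊log₂[2^n]⌋≡n ⌈log₂ n ⌉))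

⌈log₂n⌉≥1 : ∀ {n} → 2 ≤ n → 1 ≤ ⌈log₂ n ⌉
⌈log₂n⌉≥1 2≤n = ≤-trans (≤-reflexive (sym (⌈log₂2^n⌉≡n 1))) (⌈log₂⌉-mono-≤ 2≤n)

n<2^n : ∀ n → n < 2 ^ n
n<2^n zero    = s≤s z≤n
n<2^n (suc n) = ≤-trans (≤-reflexive (+-comm 1 (suc n))) (+-mono-≤ (n<2^n n) (≤-trans (m^n>0 2 n) (m≤m+n _ 0)))

^-distribʳ-* : ∀ m n o → (m * n) ^ o ≡ m ^ o * n ^ o
^-distribʳ-* m n zero    = refl
^-distribʳ-* m n (suc o) = trans (cong (m * n *_) (^-distribʳ-* m n o)) (*-interchange m n (m ^ o) (n ^ o))

bernoulli : ∀ a e h → a ^ h * (a + h * e) ≤ (a + e) ^ h * a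
bernoulli a e zero    = ≤-reflexive (cong (_+ 0) (+-identityʳ a))
bernoulli a e (suc h) = begin
  a * p * (a + suc h * e)                   ≤⟨ m≤m+n _ (p * h * e * e) ⟩
  a * p * (a + suc h * e) + p * h * e * e   ≡⟨ expand a e h p ⟩
  (a + e) * (p * (a + h * e))               ≤⟨ *-monoʳ-≤ (a + e) (bernoulli a e h) ⟩
  (a + e) * ((a + e) ^ h * a)               ≡⟨ sym (*-assoc (a + e) _ a) ⟩
  (a + e) ^ suc h * a                       ∎
  where
  open ≤-Reasoning
  p : ℕ
  p = a ^ h
  expand : ∀ a e h p → a * p * (a + (1 + h) * e) + p * h * e * e ≡ (a + e) * (p * (a + h * e))
  expand = solve-∀

c^h*2≤[c+e]^h : ∀ c e h → 0 < c + e → c + e ≤ h * e → c ^ h * 2 ≤ (c + e) ^ h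
c^h*2≤[c+e]^h c e h 0<a a≤he = *-cancelʳ-≤ _ _ (a ^ h * a) {{>-nonZero (*-mono-≤ (m^n>0 a {{>-nonZero 0<a}} h) 0<a)}} (begin
  c ^ h * 2 * (a ^ h * a)           ≡⟨ regroup (c ^ h) (a ^ h) a ⟩
  c ^ h * (a ^ h * (a + a))         ≤⟨ *-monoʳ-≤ (c ^ h) (*-monoʳ-≤ (a ^ h) (+-monoʳ-≤ a a≤he)) ⟩
  c ^ h * (a ^ h * (a + h * e))     ≤⟨ *-monoʳ-≤ (c ^ h) (bernoulli a e h) ⟩
  c ^ h * ((a + e) ^ h * a)         ≡⟨ sym (*-assoc (c ^ h) _ a) ⟩
  c ^ h * (a + e) ^ h * a           ≡⟨ cong (_* a) (sym (^-distribʳ-* c (a + e) h)) ⟩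
  (c * (a + e)) ^ h * a             ≤⟨ *-monoˡ-≤ a (^-monoˡ-≤ h (product≤square c e)) ⟩
  (a * a) ^ h * a                   ≡⟨ cong (_* a) (^-distribʳ-* a a h) ⟩
  a ^ h * a ^ h * a                 ≡⟨ *-assoc (a ^ h) _ a ⟩
  a ^ h * (a ^ h * a)               ∎)
  where
  open ≤-Reasoning
  a : ℕ
  a = c + e
  regroup : ∀ C A a → C * 2 * (A * a) ≡ C * (A * (a + a))
  regroup = solve-∀
  product≤square : ∀ c e → c * (c + e + e) ≤ (c + e) * (c + e)
  product≤square c e = ≤-trans (m≤m+n _ (e * e)) (≤-reflexive (square c e))
    where
    square : ∀ c e → c * (c + e + e) + e * e ≡ (c + e) * (c + e)
    square = solve-∀

bernoulli-decay : ∀ c h → (1 + c) ^ h * (1 + c) ≤ c ^ h * (1 + c) + h * (1 + c) ^ h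
bernoulli-decay c zero    = ≤-reflexive (sym (+-identityʳ _))
bernoulli-decay c (suc h) = begin
  a * A * a                               ≡⟨ *-assoc a A a ⟩
  a * (A * a)                             ≤⟨ *-monoʳ-≤ a (bernoulli-decay c h) ⟩
  a * (C * a + h * A)                     ≡⟨ expand c C A h ⟩
  c * C * a + C * a + h * (a * A)         ≤⟨ +-monoˡ-≤ (h * (a * A)) (+-monoʳ-≤ (c * C * a) (*-monoˡ-≤ a (^-monoˡ-≤ h (n≤1+n c)))) ⟩
  c * C * a + A * a + h * (a * A)         ≡⟨ collect (c * C * a) a A h ⟩
  c * C * a + suc h * (a * A)             ∎
  where
  open ≤-Reasoning
  a A C : ℕ
  a = 1 + c
  A = a ^ h
  C = c ^ h
  expand : ∀ c C A h → (1 + c) * (C * (1 + c) + h * A) ≡ c * C * (1 + c) + C * (1 + c) + h * ((1 + c) * A)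
  expand = solve-∀
  collect : ∀ X a A h → X + A * a + h * (a * A) ≡ X + (1 + h) * (a * A)
  collect = solve-∀

[1+c]^h≤2*c^h : ∀ c h → 2 * h ≤ 1 + c → (1 + c) ^ h ≤ 2 * c ^ h
[1+c]^h≤2*c^h c h 2h≤a = *-cancelʳ-≤ _ _ a (+-cancelʳ-≤ (A * a) _ _ (begin
  A * a + A * a         ≡⟨ cong (A * a +_) (sym (+-identityʳ (A * a))) ⟩
  2 * (A * a)           ≤⟨ *-monoʳ-≤ 2 (bernoulli-decay c h) ⟩
  2 * (C * a + h * A)   ≡⟨ *-distribˡ-+ 2 (C * a) (h * A) ⟩
  2 * (C * a) + 2 * (h * A) ≡⟨ cong (2 * (C * a) +_) (sym (*-assoc 2 h A)) ⟩
  2 * (C * a) + 2 * h * A   ≤⟨ +-monoʳ-≤ (2 * (C * a)) (*-monoˡ-≤ A 2h≤a) ⟩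
  2 * (C * a) + a * A       ≡⟨ cong₂ _+_ (sym (*-assoc 2 C a)) (*-comm a A) ⟩
  2 * C * a + A * a         ∎))
  where
  open ≤-Reasoning
  a A C : ℕ
  a = 1 + c
  A = a ^ h
  C = c ^ h

c^ρ*2^j≤[1+c]^ρ : ∀ c j ρ → suc c * j ≤ ρ → c ^ ρ * 2 ^ j ≤ suc c ^ ρ
c^ρ*2^j≤[1+c]^ρ c j ρ cj≤ρ = begin
  c ^ ρ * 2 ^ j                     ≡⟨ cong (λ t → c ^ t * 2 ^ j) (sym ρ≡cj+s) ⟩
  c ^ (cj + s) * 2 ^ j              ≡⟨ cong (_* 2 ^ j) (^-distribˡ-+-* c cj s) ⟩
  c ^ cj * c ^ s * 2 ^ j            ≡⟨ x*y*z≡x*z*y (c ^ cj) (c ^ s) (2 ^ j) ⟩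
  c ^ cj * 2 ^ j * c ^ s            ≤⟨ *-mono-≤ halved (^-monoˡ-≤ s (n≤1+n c)) ⟩
  suc c ^ cj * suc c ^ s            ≡⟨ sym (^-distribˡ-+-* (suc c) cj s) ⟩
  suc c ^ (cj + s)                  ≡⟨ cong (suc c ^_) ρ≡cj+s ⟩
  suc c ^ ρ                         ∎
  where
  open ≤-Reasoning
  cj s : ℕ
  cj = suc c * j
  s = ρ ∸ cj
  ρ≡cj+s : cj + s ≡ ρ
  ρ≡cj+s = m+[n∸m]≡n cj≤ρ
  once : c ^ suc c * 2 ≤ suc c ^ suc c
  once = subst (λ a → c ^ suc c * 2 ≤ a ^ suc c) (+-comm c 1)
           (c^h*2≤[c+e]^h c 1 (suc c) (subst (0 <_) (+-comm 1 c) (s≤s z≤n)) (≤-reflexive (trans (+-comm c 1) (sym (*-identityʳ (suc c))))))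
  halved : c ^ cj * 2 ^ j ≤ suc c ^ cj
  halved = begin
    c ^ cj * 2 ^ j                  ≡⟨ cong (_* 2 ^ j) (sym (^-*-assoc c (suc c) j)) ⟩
    (c ^ suc c) ^ j * 2 ^ j         ≡⟨ sym (^-distribʳ-* (c ^ suc c) 2 j) ⟩
    (c ^ suc c * 2) ^ j             ≤⟨ ^-monoˡ-≤ j once ⟩
    (suc c ^ suc c) ^ j             ≡⟨ ^-*-assoc (suc c) (suc c) j ⟩
    suc c ^ cj                      ∎

[1+c]^d≤2^q*c^d : ∀ c h q d → 0 < c → 2 * h ≤ 1 + c → d ≤ h * q → (1 + c) ^ d ≤ 2 ^ q * c ^ d
[1+c]^d≤2^q*c^d c h q d 0<c 2h≤1+c d≤hq = *-cancelʳ-≤ _ _ (c ^ s) {{m^n≢0 c s {{>-nonZero 0<c}}}} (begin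
  a ^ d * c ^ s                     ≤⟨ *-monoʳ-≤ (a ^ d) (^-monoˡ-≤ s (n≤1+n c)) ⟩
  a ^ d * a ^ s                     ≡⟨ sym (^-distribˡ-+-* a d s) ⟩
  a ^ (d + s)                       ≡⟨ cong (a ^_) d+s≡hq ⟩
  a ^ (h * q)                       ≡⟨ sym (^-*-assoc a h q) ⟩
  (a ^ h) ^ q                       ≤⟨ ^-monoˡ-≤ q ([1+c]^h≤2*c^h c h 2h≤1+c) ⟩
  (2 * c ^ h) ^ q                   ≡⟨ ^-distribʳ-* 2 (c ^ h) q ⟩
  2 ^ q * (c ^ h) ^ q               ≡⟨ cong (2 ^ q *_) (^-*-assoc c h q) ⟩
  2 ^ q * c ^ (h * q)               ≡⟨ cong (λ t → 2 ^ q * c ^ t) (sym d+s≡hq) ⟩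
  2 ^ q * c ^ (d + s)               ≡⟨ cong (2 ^ q *_) (^-distribˡ-+-* c d s) ⟩
  2 ^ q * (c ^ d * c ^ s)           ≡⟨ sym (*-assoc (2 ^ q) _ _) ⟩
  2 ^ q * c ^ d * c ^ s             ∎)
  where
  open ≤-Reasoning
  a s : ℕ
  a = 1 + c
  s = h * q ∸ d
  d+s≡hq : d + s ≡ h * q
  d+s≡hq = m+[n∸m]≡n d≤hq

a^n*[1+a]^m≤[1+a]^n*a^m : ∀ a {m n} → m ≤ n → a ^ n * suc a ^ m ≤ suc a ^ n * a ^ m
a^n*[1+a]^m≤[1+a]^n*a^m a {m} {n} m≤n = begin
  a ^ n * suc a ^ m                 ≡⟨ cong (λ t → a ^ t * suc a ^ m) (sym m+e≡n) ⟩
  a ^ (m + e) * suc a ^ m           ≡⟨ cong (_* suc a ^ m) (^-distribˡ-+-* a m e) ⟩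
  a ^ m * a ^ e * suc a ^ m         ≤⟨ *-monoˡ-≤ (suc a ^ m) (*-monoʳ-≤ (a ^ m) (^-monoˡ-≤ e (n≤1+n a))) ⟩
  a ^ m * suc a ^ e * suc a ^ m     ≡⟨ x*y*z≡z*y*x (a ^ m) (suc a ^ e) (suc a ^ m) ⟩
  suc a ^ m * suc a ^ e * a ^ m     ≡⟨ cong (_* a ^ m) (sym (^-distribˡ-+-* (suc a) m e)) ⟩
  suc a ^ (m + e) * a ^ m           ≡⟨ cong (λ t → suc a ^ t * a ^ m) m+e≡n ⟩
  suc a ^ n * a ^ m                 ∎
  where
  open ≤-Reasoning
  e : ℕ
  e = n ∸ m
  m+e≡n : m + e ≡ n
  m+e≡n = m+[n∸m]≡n m≤n

b^[E₁*E₂]*2^E₂≤N^[E₁*E₂] : ∀ {b g N} E₁ E₂ → b + g ≡ N → 0 < N → N ≤ E₁ * g →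
  b ^ (E₁ * E₂) * 2 ^ E₂ ≤ N ^ (E₁ * E₂)
b^[E₁*E₂]*2^E₂≤N^[E₁*E₂] {b} {g} {N} E₁ E₂ b+g≡N 0<N N≤E₁g = begin
  b ^ (E₁ * E₂) * 2 ^ E₂        ≡⟨ cong (_* 2 ^ E₂) (sym (^-*-assoc b E₁ E₂)) ⟩
  (b ^ E₁) ^ E₂ * 2 ^ E₂        ≡⟨ sym (^-distribʳ-* (b ^ E₁) 2 E₂) ⟩
  (b ^ E₁ * 2) ^ E₂             ≤⟨ ^-monoˡ-≤ E₂ halved ⟩
  (N ^ E₁) ^ E₂                 ≡⟨ ^-*-assoc N E₁ E₂ ⟩
  N ^ (E₁ * E₂)                 ∎
  where
  open ≤-Reasoning
  halved : b ^ E₁ * 2 ≤ N ^ E₁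
  halved = subst (λ N → b ^ E₁ * 2 ≤ N ^ E₁) b+g≡N
             (c^h*2≤[c+e]^h b g E₁ (subst (0 <_) (sym b+g≡N) 0<N) (subst (_≤ E₁ * g) (sym b+g≡N) N≤E₁g))

-- Hamming distance

mismatch : Bool → Bool → ℕ
mismatch true  true  = 0
mismatch false false = 0
mismatch _     _     = 1

^-hamming-∷ : ∀ k {d} a b (u v : Point d) → k ^ hamming (a ∷ u) (b ∷ v) ≡ k ^ mismatch a b * k ^ hamming u v
^-hamming-∷ k true  true  u v = sym (*-identityˡ _)
^-hamming-∷ k false false u v = sym (*-identityˡ _)
^-hamming-∷ k true  false u v = ^-distribˡ-+-* k 1 (hamming u v)
^-hamming-∷ k false true  u v = ^-distribˡ-+-* k 1 (hamming u v)

nearerTo : ∀ {d} → Point d → Point d → Point d → Bool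
nearerTo w x y = hamming y w ≤ᵇ hamming y x

hamming-self : ∀ {d} (x : Point d) → hamming x x ≡ 0
hamming-self []          = refl
hamming-self (true ∷ x)  = hamming-self x
hamming-self (false ∷ x) = hamming-self x

-- Weights tilted towards a point

module Tilted (m : ℕ) where

  M : ℕ
  M = suc m

  agreement : Bool → Bool → ℕ
  agreement true  true  = 2 + m
  agreement false false = 2 + m
  agreement _     _     = m

  towards : ∀ {d} → Point d → Vec (Bool → ℕ) d
  towards = Data.Vec.map agreement

  tilted : ∀ {d} → Point d → Point d → ℕ
  tilted x = weight (towards x)

  totalWeight-towards : ∀ {d} (x : Point d) → totalWeight (towards x) ≡ (2 * M) ^ d
  totalWeight-towards []      = refl
  totalWeight-towards (a ∷ x) = cong₂ _*_ (coordinate a) (totalWeight-towards x)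
    where
    sum-eq : ∀ m → 2 + m + m ≡ 2 * suc m
    sum-eq = solve-∀
    coordinate : ∀ a → agreement a false + agreement a true ≡ 2 * M
    coordinate true  = trans (+-comm m (2 + m)) (sum-eq m)
    coordinate false = sum-eq m

  totalWeight-square-towards : ∀ {d} (x : Point d) → totalWeight (squareWeights (towards x)) ≡ (2 * (1 + M * M)) ^ d
  totalWeight-square-towards []      = refl
  totalWeight-square-towards (a ∷ x) = cong₂ _*_ (coordinate a) (totalWeight-square-towards x)
    where
    squares : ∀ m → (2 + m) * (2 + m) + m * m ≡ 2 * (1 + suc m * suc m)
    squares = solve-∀
    coordinate : ∀ a → agreement a false * agreement a false + agreement a true * agreement a true ≡ 2 * (1 + M * M)
    coordinate true  = trans (+-comm (m * m) _) (squares m)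
    coordinate false = squares m

  -- By `tilt`, weight (comparisonWeights x w) y = M^d · tilted x y · ((M+1)/M)^(|y-x| - |y-w|):
  -- the exponential tilt behind the Chernoff bound `nearer-tilted-mass`.
  comparison : Bool → Bool → Bool → ℕ
  comparison true  true  c     = M * agreement true c
  comparison false false c     = M * agreement false c
  comparison true  false true  = M * M
  comparison false true  false = M * M
  comparison true  false false = m * (2 + m)
  comparison false true  true  = m * (2 + m)

  comparisonWeights : ∀ {d} → Point d → Point d → Vec (Bool → ℕ) d
  comparisonWeights = Data.Vec.zipWith comparison

  private
    y-agrees-with-x : ∀ M N → M * M * (1 * (N * 1)) ≡ M * N * (1 * (M * 1))
    y-agrees-with-x = solve-∀
    y-agrees-with-w : ∀ m M N → m * N * (M * 1 * 1) ≡ M * m * (N * 1 * 1)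
    y-agrees-with-w = solve-∀

  comparison-tilt : ∀ a b c →
    comparison a b c * (M ^ mismatch c a * suc M ^ mismatch c b) ≡ M * agreement a c * (suc M ^ mismatch c a * M ^ mismatch c b)
  comparison-tilt true  true  true  = refl
  comparison-tilt false false false = refl
  comparison-tilt true  true  false = cong (M * m *_) (*-comm (M * 1) _)
  comparison-tilt false false true  = cong (M * m *_) (*-comm (M * 1) _)
  comparison-tilt true  false true  = y-agrees-with-x M (suc M)
  comparison-tilt false true  false = y-agrees-with-x M (suc M)
  comparison-tilt true  false false = y-agrees-with-w m M (suc M)
  comparison-tilt false true  true  = y-agrees-with-w m M (suc M)

  equalMass unequalMass : ℕ
  equalMass   = 2 * M * M
  unequalMass = M * M + m * (2 + m)

  suc-unequalMass : suc unequalMass ≡ equalMass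
  suc-unequalMass = masses m
    where
    masses : ∀ m → suc (suc m * suc m + m * (2 + m)) ≡ 2 * suc m * suc m
    masses = solve-∀

  private
    x-agrees-with-w : ∀ m → suc m * (2 + m) + suc m * m ≡ 2 * suc m * suc m
    x-agrees-with-w = solve-∀
    x-disagrees-with-w : ∀ a b → a * (b * 1) ≡ b * (a * 1)
    x-disagrees-with-w = solve-∀

  comparison-mass : ∀ a b →
    (comparison a b false + comparison a b true) * equalMass ^ mismatch a b ≡ equalMass * unequalMass ^ mismatch a b
  comparison-mass true  true  = cong (_* 1) (trans (+-comm (M * m) _) (x-agrees-with-w m))
  comparison-mass false false = cong (_* 1) (x-agrees-with-w m)
  comparison-mass true  false = trans (cong (_* (equalMass * 1)) (+-comm (m * (2 + m)) (M * M))) (x-disagrees-with-w unequalMass equalMass)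
  comparison-mass false true  = x-disagrees-with-w unequalMass equalMass

  tilt : ∀ {d} (x w y : Point d) →
    weight (comparisonWeights x w) y * (M ^ hamming y x * suc M ^ hamming y w)
      ≡ M ^ d * tilted x y * (suc M ^ hamming y x * M ^ hamming y w)
  tilt [] [] [] = refl
  tilt {suc d} (a ∷ x) (b ∷ w) (c ∷ y) = begin
    C * W * (M ^ hamming (c ∷ y) (a ∷ x) * N ^ hamming (c ∷ y) (b ∷ w))
      ≡⟨ cong (C * W *_) (cong₂ _*_ (^-hamming-∷ M c a y x) (^-hamming-∷ N c b y w)) ⟩
    C * W * (M ^ mismatch c a * M ^ hamming y x * (N ^ mismatch c b * N ^ hamming y w))
      ≡⟨ cong (C * W *_) (*-interchange (M ^ mismatch c a) (M ^ hamming y x) (N ^ mismatch c b) (N ^ hamming y w)) ⟩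
    C * W * (M ^ mismatch c a * N ^ mismatch c b * (M ^ hamming y x * N ^ hamming y w))
      ≡⟨ *-interchange C W _ _ ⟩
    C * (M ^ mismatch c a * N ^ mismatch c b) * (W * (M ^ hamming y x * N ^ hamming y w))
      ≡⟨ cong₂ _*_ (comparison-tilt a b c) (tilt x w y) ⟩
    M * g * (N ^ mismatch c a * M ^ mismatch c b) * (M ^ d * t * (N ^ hamming y x * M ^ hamming y w))
      ≡⟨ *-interchange (M * g) _ _ _ ⟩
    M * g * (M ^ d * t) * (N ^ mismatch c a * M ^ mismatch c b * (N ^ hamming y x * M ^ hamming y w))
      ≡⟨ cong₂ _*_ (*-interchange M g (M ^ d) t) (*-interchange (N ^ mismatch c a) (M ^ mismatch c b) (N ^ hamming y x) (M ^ hamming y w)) ⟩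
    M * M ^ d * (g * t) * (N ^ mismatch c a * N ^ hamming y x * (M ^ mismatch c b * M ^ hamming y w))
      ≡⟨ cong (M * M ^ d * (g * t) *_) (sym (cong₂ _*_ (^-hamming-∷ N c a y x) (^-hamming-∷ M c b y w))) ⟩
    M ^ suc d * (g * t) * (N ^ hamming (c ∷ y) (a ∷ x) * M ^ hamming (c ∷ y) (b ∷ w))
      ∎
    where
    open ≡-Reasoning
    N C W g t : ℕ
    N = suc M
    C = comparison a b c
    W = weight (comparisonWeights x w) y
    g = agreement a c
    t = tilted x y

  totalWeight-comparison : ∀ {d} (x w : Point d) →
    totalWeight (comparisonWeights x w) * equalMass ^ hamming x w ≡ equalMass ^ d * unequalMass ^ hamming x w
  totalWeight-comparison [] [] = refl
  totalWeight-comparison {suc d} (a ∷ x) (b ∷ w) = begin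
    C * Tc * E ^ hamming (a ∷ x) (b ∷ w)                      ≡⟨ cong (C * Tc *_) (^-hamming-∷ E a b x w) ⟩
    C * Tc * (E ^ mismatch a b * E ^ hamming x w)             ≡⟨ *-interchange C Tc _ _ ⟩
    C * E ^ mismatch a b * (Tc * E ^ hamming x w)             ≡⟨ cong₂ _*_ (comparison-mass a b) (totalWeight-comparison x w) ⟩
    E * U ^ mismatch a b * (E ^ d * U ^ hamming x w)         ≡⟨ *-interchange E (U ^ mismatch a b) (E ^ d) (U ^ hamming x w) ⟩
    E ^ suc d * (U ^ mismatch a b * U ^ hamming x w)         ≡⟨ cong (E ^ suc d *_) (sym (^-hamming-∷ U a b x w)) ⟩
    E ^ suc d * U ^ hamming (a ∷ x) (b ∷ w)                  ∎
    where
    open ≡-Reasoning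
    C Tc E U : ℕ
    C = comparison a b false + comparison a b true
    Tc = totalWeight (comparisonWeights x w)
    E = equalMass
    U = unequalMass

  nearer-tilted≤comparison : ∀ {d} (x w y : Point d) →
    𝟙 (nearerTo w x y) * tilted x y * M ^ d ≤ weight (comparisonWeights x w) y
  nearer-tilted≤comparison {d} x w y with nearerTo w x y in eq
  ... | false = z≤n
  ... | true  = ≤-trans (≤-reflexive (trans (cong (_* M ^ d) (*-identityˡ (tilted x y))) (*-comm _ (M ^ d))))
                  (*-cancelʳ-≤ _ _ B {{m*n≢0 _ _ {{m^n≢0 (suc M) hx}} {{m^n≢0 M hw}}}} (begin
    M ^ d * tilted x y * B                                   ≡⟨ sym (tilt x w y) ⟩
    weight (comparisonWeights x w) y * (M ^ hx * suc M ^ hw) ≤⟨ *-monoʳ-≤ (weight (comparisonWeights x w) y) (a^n*[1+a]^m≤[1+a]^n*a^m M hw≤hx) ⟩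
    weight (comparisonWeights x w) y * B                     ∎))
    where
    open ≤-Reasoning
    hx hw : ℕ
    hx = hamming y x
    hw = hamming y w
    hw≤hx : hw ≤ hx
    hw≤hx = ≤ᵇ⇒≤ hw hx (subst T (sym eq) _)
    B : ℕ
    B = suc M ^ hx * M ^ hw

  totalWeight-comparison-far : ∀ {d} j (x w : Point d) → equalMass * j ≤ hamming x w →
    totalWeight (comparisonWeights x w) * 2 ^ j ≤ equalMass ^ d
  totalWeight-comparison-far {d} j x w Ej≤ρ = *-cancelʳ-≤ _ _ (E ^ ρ) {{m^n≢0 E ρ {{>-nonZero 0<E}}}} (begin
    Tc * 2 ^ j * E ^ ρ          ≡⟨ x*y*z≡x*z*y Tc (2 ^ j) (E ^ ρ) ⟩
    Tc * E ^ ρ * 2 ^ j          ≡⟨ cong (_* 2 ^ j) (totalWeight-comparison x w) ⟩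
    E ^ d * U ^ ρ * 2 ^ j       ≡⟨ *-assoc (E ^ d) _ _ ⟩
    E ^ d * (U ^ ρ * 2 ^ j)     ≤⟨ *-monoʳ-≤ (E ^ d) (subst (λ e → U ^ ρ * 2 ^ j ≤ e ^ ρ) suc-unequalMass
                                     (c^ρ*2^j≤[1+c]^ρ U j ρ (subst (λ e → e * j ≤ ρ) (sym suc-unequalMass) Ej≤ρ))) ⟩
    E ^ d * E ^ ρ               ∎)
    where
    open ≤-Reasoning
    E U ρ Tc : ℕ
    E = equalMass
    U = unequalMass
    ρ = hamming x w
    Tc = totalWeight (comparisonWeights x w)
    0<E : 0 < E
    0<E = subst (0 <_) suc-unequalMass (s≤s z≤n)

  nearer-tilted-mass : ∀ {d} j (x w : Point d) → equalMass * j ≤ hamming x w →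
    ∑[ y ∈ allPoints d ] (𝟙 (nearerTo w x y) * tilted x y) * 2 ^ j ≤ (2 * M) ^ d
  nearer-tilted-mass {d} j x w Ej≤ρ = *-cancelʳ-≤ _ _ (M ^ d) {{m^n≢0 M d}} (begin
    S * 2 ^ j * M ^ d                                             ≡⟨ x*y*z≡x*z*y S (2 ^ j) (M ^ d) ⟩
    S * M ^ d * 2 ^ j                                             ≡⟨ cong (_* 2 ^ j) (sym (∑-*ʳ (M ^ d) (allPoints d) _)) ⟩
    ∑[ y ∈ allPoints d ] (𝟙 (nearerTo w x y) * tilted x y * M ^ d) * 2 ^ j
                                                                  ≤⟨ *-monoˡ-≤ (2 ^ j) (∑-mono-≤ (allPoints d) (nearer-tilted≤comparison x w)) ⟩
    ∑ (allPoints d) (weight (comparisonWeights x w)) * 2 ^ j      ≡⟨ cong (_* 2 ^ j) (∑-weight (comparisonWeights x w)) ⟩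
    totalWeight (comparisonWeights x w) * 2 ^ j                   ≤⟨ totalWeight-comparison-far j x w Ej≤ρ ⟩
    (2 * M * M) ^ d                                               ≡⟨ ^-distribʳ-* (2 * M) M d ⟩
    (2 * M) ^ d * M ^ d                                           ∎)
    where
    open ≤-Reasoning
    S : ℕ
    S = ∑[ y ∈ allPoints d ] (𝟙 (nearerTo w x y) * tilted x y)

module NearestAnswer (m : ℕ) {d n} (H : Vec (Point d) n) (ans : Point d → Fin n) (nn : IsNNOracle H ans)
                     (i : Fin n) (L : ℕ) (n≤2^L : n ≤ 2 ^ L) where

  open Tilted m

  x : Point d
  x = lookup H i

  -- equalMass * (L + 2), so that each far point of H is charged at most 2^-(L+2) of the tilted mass.
  r : ℕ
  r = 2 * M * M * (L + 2)

  bad : Point d → Bool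
  bad = answerFar H ans x r

  far : Fin n → Bool
  far j = r <ᵇ hamming x (lookup H j)

  tiltedMass : (Point d → Bool) → ℕ
  tiltedMass p = ∑[ y ∈ allPoints d ] (𝟙 (p y) * tilted x y)

  charge : Fin n → Point d → ℕ
  charge j y = 𝟙 (far j) * (𝟙 (nearerTo (lookup H j) x y) * tilted x y)

  bad-tilted≤∑charge : ∀ y → 𝟙 (bad y) * tilted x y ≤ ∑[ j ∈ allFin n ] charge j y
  bad-tilted≤∑charge y with bad y in eq
  ... | false = z≤n
  ... | true  = ≤-trans (≤-reflexive charge-of-answer) (∑-≥-term (allFin n) (λ j → charge j y) (∈-allFin (ans y)))
    where
    nearer : nearerTo (lookup H (ans y)) x y ≡ true
    nearer = Equivalence.to T-≡ (≤⇒≤ᵇ (nn y i))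
    charge-of-answer : 1 * tilted x y ≡ charge (ans y) y
    charge-of-answer rewrite eq | nearer = cong (_+ 0) (sym (+-identityʳ _))

  ∑charge*2^[L+2]≤total : ∀ j → ∑ (allPoints d) (charge j) * 2 ^ (L + 2) ≤ (2 * M) ^ d
  ∑charge*2^[L+2]≤total j with far j in eq
  ... | false = subst (λ s → s * 2 ^ (L + 2) ≤ (2 * M) ^ d) (sym (∑-*ˡ 0 (allPoints d) (λ _ → 0))) z≤n
  ... | true  = subst (λ s → s * 2 ^ (L + 2) ≤ (2 * M) ^ d)
                  (∑-cong (allPoints d) (λ y → sym (*-identityˡ _)))
                  (nearer-tilted-mass (L + 2) x (lookup H j) (<⇒≤ (<ᵇ⇒< r _ (subst T (sym eq) _))))

  badMass*4≤total : tiltedMass bad * 4 ≤ (2 * M) ^ d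
  badMass*4≤total = *-cancelʳ-≤ _ _ (2 ^ L) {{m^n≢0 2 L}} (begin
    tiltedMass bad * 4 * 2 ^ L                                ≡⟨ trans (x*y*z≡x*z*y (tiltedMass bad) 4 (2 ^ L)) (*-assoc (tiltedMass bad) (2 ^ L) 4) ⟩
    tiltedMass bad * (2 ^ L * 4)                              ≡⟨ cong (tiltedMass bad *_) (sym (^-distribˡ-+-* 2 L 2)) ⟩
    tiltedMass bad * 2 ^ (L + 2)                              ≤⟨ *-monoˡ-≤ (2 ^ (L + 2)) (∑-mono-≤ (allPoints d) bad-tilted≤∑charge) ⟩
    ∑[ y ∈ allPoints d ] ∑[ j ∈ allFin n ] charge j y * 2 ^ (L + 2)
                                                              ≡⟨ cong (_* 2 ^ (L + 2)) (∑-swap (allPoints d) (allFin n) (λ y j → charge j y)) ⟩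
    ∑[ j ∈ allFin n ] ∑ (allPoints d) (charge j) * 2 ^ (L + 2)
                                                              ≡⟨ sym (∑-*ʳ (2 ^ (L + 2)) (allFin n) (λ j → ∑ (allPoints d) (charge j))) ⟩
    ∑[ j ∈ allFin n ] (∑ (allPoints d) (charge j) * 2 ^ (L + 2))
                                                              ≤⟨ ∑-≤-length* (allFin n) _ ∑charge*2^[L+2]≤total ⟩
    length (allFin n) * (2 * M) ^ d                           ≡⟨ cong (_* (2 * M) ^ d) (length-tabulate {n = n} id) ⟩
    n * (2 * M) ^ d                                           ≤⟨ *-monoˡ-≤ ((2 * M) ^ d) n≤2^L ⟩
    2 ^ L * (2 * M) ^ d                                       ≡⟨ *-comm (2 ^ L) _ ⟩
    (2 * M) ^ d * 2 ^ L                                       ∎)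
    where open ≤-Reasoning

  good : Point d → Bool
  good y = not (bad y)

  goodCount : ℕ
  goodCount = ∑[ y ∈ allPoints d ] 𝟙 (good y)

  total≤2*goodMass : (2 * M) ^ d ≤ 2 * tiltedMass good
  total≤2*goodMass = +-cancelʳ-≤ (2 * tiltedMass bad) _ _ (begin
    Tw + 2 * tiltedMass bad                         ≤⟨ +-monoʳ-≤ Tw (≤-trans (*-monoˡ-≤ (tiltedMass bad) (m≤m+n 2 2)) (≤-reflexive (*-comm 4 (tiltedMass bad)))) ⟩
    Tw + tiltedMass bad * 4                         ≤⟨ +-monoʳ-≤ Tw badMass*4≤total ⟩
    Tw + Tw                                         ≡⟨ cong (λ t → t + t) (sym good+bad) ⟩
    (tiltedMass good + tiltedMass bad) + (tiltedMass good + tiltedMass bad)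
                                                    ≡⟨ double-sum (tiltedMass good) (tiltedMass bad) ⟩
    2 * tiltedMass good + 2 * tiltedMass bad        ∎)
    where
    open ≤-Reasoning
    Tw : ℕ
    Tw = (2 * M) ^ d
    good+bad : tiltedMass good + tiltedMass bad ≡ Tw
    good+bad = begin-equality
      tiltedMass good + tiltedMass bad              ≡⟨ sym (∑-+ (allPoints d) _ _) ⟩
      ∑[ y ∈ allPoints d ] (𝟙 (good y) * tilted x y + 𝟙 (bad y) * tilted x y)
                                                    ≡⟨ ∑-cong (allPoints d) (λ y → 𝟙-not-+ (bad y) (tilted x y)) ⟩
      ∑ (allPoints d) (tilted x)                    ≡⟨ ∑-weight (towards x) ⟩
      totalWeight (towards x)                       ≡⟨ totalWeight-towards x ⟩
      Tw                                            ∎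
    double-sum : ∀ a b → (a + b) + (a + b) ≡ 2 * a + 2 * b
    double-sum = solve-∀

  goodMass²≤goodCount*squares : tiltedMass good * tiltedMass good ≤ goodCount * (2 * (1 + M * M)) ^ d
  goodMass²≤goodCount*squares = begin
    tiltedMass good * tiltedMass good              ≡⟨ cong₂ _*_ as-inner-product as-inner-product ⟩
    ∑[ y ∈ allPoints d ] (f y * g y) * ∑[ y ∈ allPoints d ] (f y * g y)
                                                   ≤⟨ cauchy-schwarz (allPoints d) f g ⟩
    ∑[ y ∈ allPoints d ] (f y * f y) * ∑[ y ∈ allPoints d ] (g y * g y)
                                                   ≤⟨ *-mono-≤ (≤-reflexive (∑-cong (allPoints d) (λ y → 𝟙*𝟙 (good y)))) g²≤squares ⟩
    goodCount * (2 * (1 + M * M)) ^ d              ∎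
    where
    open ≤-Reasoning
    f g : Point d → ℕ
    f y = 𝟙 (good y)
    g y = 𝟙 (good y) * tilted x y
    as-inner-product : tiltedMass good ≡ ∑[ y ∈ allPoints d ] (f y * g y)
    as-inner-product = ∑-cong (allPoints d) (λ y →
      trans (cong (_* tilted x y) (sym (𝟙*𝟙 (good y)))) (*-assoc (f y) (f y) (tilted x y)))
    g²≤squares : ∑[ y ∈ allPoints d ] (g y * g y) ≤ (2 * (1 + M * M)) ^ d
    g²≤squares = begin
      ∑[ y ∈ allPoints d ] (g y * g y)                        ≤⟨ ∑-mono-≤ (allPoints d) (λ y → *-mono-≤ (𝟙*≤ (good y) _) (𝟙*≤ (good y) _)) ⟩
      ∑[ y ∈ allPoints d ] (tilted x y * tilted x y)          ≡⟨ ∑-cong (allPoints d) (weight-square (towards x)) ⟩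
      ∑ (allPoints d) (weight (squareWeights (towards x)))    ≡⟨ ∑-weight (squareWeights (towards x)) ⟩
      totalWeight (squareWeights (towards x))                 ≡⟨ totalWeight-square-towards x ⟩
      (2 * (1 + M * M)) ^ d                                   ∎

  2^d≤2^[q+2]*goodCount : ∀ q h → d ≤ h * q → 2 * h ≤ 1 + M * M → 2 ^ d ≤ 2 ^ (q + 2) * goodCount
  2^d≤2^[q+2]*goodCount q h d≤hq 2h≤1+c = *-cancelʳ-≤ _ _ (2 ^ d * c ^ d) {{m*n≢0 _ _ {{m^n≢0 2 d}} {{m^n≢0 c d {{m*n≢0 M M}}}}}} (begin
    2 ^ d * (2 ^ d * c ^ d)                        ≡⟨ sym total² ⟩
    (2 * M) ^ d * (2 * M) ^ d                      ≤⟨ *-mono-≤ total≤2*goodMass total≤2*goodMass ⟩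
    2 * G * (2 * G)                                ≡⟨ square-double G ⟩
    4 * (G * G)                                    ≤⟨ *-monoʳ-≤ 4 goodMass²≤goodCount*squares ⟩
    4 * (goodCount * (2 * (1 + c)) ^ d)            ≡⟨ cong (λ t → 4 * (goodCount * t)) (^-distribʳ-* 2 (1 + c) d) ⟩
    4 * (goodCount * (2 ^ d * (1 + c) ^ d))        ≤⟨ *-monoʳ-≤ 4 (*-monoʳ-≤ goodCount (*-monoʳ-≤ (2 ^ d)
                                                        ([1+c]^d≤2^q*c^d c h q d (*-mono-≤ {1} {M} {1} {M} (s≤s z≤n) (s≤s z≤n)) 2h≤1+c d≤hq))) ⟩
    4 * (goodCount * (2 ^ d * (2 ^ q * c ^ d)))    ≡⟨ regroup goodCount (2 ^ d) (2 ^ q) (c ^ d) ⟩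
    2 ^ q * 4 * goodCount * (2 ^ d * c ^ d)        ≡⟨ cong (λ t → t * goodCount * (2 ^ d * c ^ d)) (sym (^-distribˡ-+-* 2 q 2)) ⟩
    2 ^ (q + 2) * goodCount * (2 ^ d * c ^ d)      ∎)
    where
    open ≤-Reasoning
    c G : ℕ
    c = M * M
    G = tiltedMass good
    total² : (2 * M) ^ d * (2 * M) ^ d ≡ 2 ^ d * (2 ^ d * c ^ d)
    total² = begin-equality
      (2 * M) ^ d * (2 * M) ^ d                    ≡⟨ sym (^-distribʳ-* (2 * M) (2 * M) d) ⟩
      (2 * M * (2 * M)) ^ d                        ≡⟨ cong (_^ d) (*-interchange 2 M 2 M) ⟩
      (2 * 2 * c) ^ d                              ≡⟨ ^-distribʳ-* (2 * 2) c d ⟩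
      (2 * 2) ^ d * c ^ d                          ≡⟨ cong (_* c ^ d) (^-distribʳ-* 2 2 d) ⟩
      2 ^ d * 2 ^ d * c ^ d                        ≡⟨ *-assoc (2 ^ d) (2 ^ d) (c ^ d) ⟩
      2 ^ d * (2 ^ d * c ^ d)                      ∎
    square-double : ∀ s → 2 * s * (2 * s) ≡ 4 * (s * s)
    square-double = solve-∀
    regroup : ∀ g a b e → 4 * (g * (a * (b * e))) ≡ b * 4 * g * (a * e)
    regroup = solve-∀

  badCount+goodCount : count bad (allPoints d) + goodCount ≡ 2 ^ d
  badCount+goodCount = begin-equality
    count bad (allPoints d) + goodCount                       ≡⟨ cong (_+ goodCount) (count≡∑𝟙 bad (allPoints d)) ⟩
    ∑ (allPoints d) (𝟙 ∘ bad) + goodCount                     ≡⟨ +-comm _ goodCount ⟩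
    goodCount + ∑ (allPoints d) (𝟙 ∘ bad)                     ≡⟨ sym (∑-+ (allPoints d) _ _) ⟩
    ∑[ y ∈ allPoints d ] (𝟙 (good y) + 𝟙 (bad y))             ≡⟨ ∑-cong (allPoints d) (λ y → sym (cong₂ _+_ (*-identityʳ (𝟙 (good y))) (*-identityʳ (𝟙 (bad y))))) ⟩
    ∑[ y ∈ allPoints d ] (𝟙 (good y) * 1 + 𝟙 (bad y) * 1)     ≡⟨ ∑-cong (allPoints d) (λ y → 𝟙-not-+ (bad y) 1) ⟩
    ∑[ _ ∈ allPoints d ] 1                                     ≡⟨ ∑-allPoints-1 d ⟩
    2 ^ d                                                      ∎
    where open ≤-Reasoning

  bad-samples-rare : ∀ q h → d ≤ h * q → 2 * h ≤ 1 + M * M →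
    3 * n * count (badSample H ans x r) (tuples (2 ^ ((q + 2) + (L + 2))) (allPoints d)) ≤ 2 ^ (d * 2 ^ ((q + 2) + (L + 2)))
  bad-samples-rare q h d≤hq 2h≤1+c = begin
    3 * n * count (badSample H ans x r) (tuples (2 ^ k) (allPoints d))  ≡⟨ cong (3 * n *_) (count-badSample-tuples H ans x r (2 ^ k) (allPoints d)) ⟩
    3 * n * B ^ (2 ^ k)                     ≡⟨ cong (λ t → 3 * n * B ^ t) (^-distribˡ-+-* 2 (q + 2) (L + 2)) ⟩
    3 * n * B ^ (E₁ * E₂)                   ≤⟨ *-monoˡ-≤ (B ^ (E₁ * E₂)) 3n≤2^E₂ ⟩
    2 ^ E₂ * B ^ (E₁ * E₂)                  ≡⟨ *-comm (2 ^ E₂) _ ⟩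
    B ^ (E₁ * E₂) * 2 ^ E₂                  ≤⟨ b^[E₁*E₂]*2^E₂≤N^[E₁*E₂] E₁ E₂ badCount+goodCount (m^n>0 2 d) (2^d≤2^[q+2]*goodCount q h d≤hq 2h≤1+c) ⟩
    (2 ^ d) ^ (E₁ * E₂)                     ≡⟨ ^-*-assoc 2 d (E₁ * E₂) ⟩
    2 ^ (d * (E₁ * E₂))                     ≡⟨ cong (λ t → 2 ^ (d * t)) (sym (^-distribˡ-+-* 2 (q + 2) (L + 2))) ⟩
    2 ^ (d * 2 ^ k)                         ∎
    where
    open ≤-Reasoning
    k E₁ E₂ B : ℕ
    k = (q + 2) + (L + 2)
    E₁ = 2 ^ (q + 2)
    E₂ = 2 ^ (L + 2)
    B = count bad (allPoints d)
    3n≤2^E₂ : 3 * n ≤ 2 ^ E₂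
    3n≤2^E₂ = begin
      3 * n                   ≤⟨ *-monoˡ-≤ n (n≤1+n 3) ⟩
      4 * n                   ≤⟨ *-monoʳ-≤ 4 n≤2^L ⟩
      4 * 2 ^ L               ≡⟨ trans (*-comm 4 (2 ^ L)) (sym (^-distribˡ-+-* 2 L 2)) ⟩
      E₂                      ≤⟨ <⇒≤ (n<2^n E₂) ⟩
      2 ^ E₂                  ∎

-- Choice of parameters

⌊⁴√⌋-exists : ∀ P → 1 ≤ P → ∀ d → ∃[ M ] (M ^ 4 * P ≤ d × d < suc M ^ 4 * P)
⌊⁴√⌋-exists P 1≤P zero = 0 , z≤n , ≤-trans 1≤P (≤-reflexive (sym (+-identityʳ P)))
⌊⁴√⌋-exists P 1≤P (suc d) with ⌊⁴√⌋-exists P 1≤P d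
... | M , lo , hi with suc M ^ 4 * P ≤? suc d
...   | yes next≤ = suc M , next≤ , (begin-strict
        suc d                 ≤⟨ hi ⟩
        suc M ^ 4 * P         <⟨ *-monoˡ-< P {{>-nonZero 1≤P}} (^-monoˡ-< 4 (n<1+n (suc M))) ⟩
        suc (suc M) ^ 4 * P   ∎)
  where open ≤-Reasoning
...   | no next≰ = M , ≤-trans lo (n≤1+n d) , ≰⇒> next≰

^4≡square² : ∀ M → M ^ 4 ≡ M * M * (M * M)
^4≡square² M = unfolded M
  where
  unfolded : ∀ M → M * (M * (M * (M * 1))) ≡ M * M * (M * M)
  unfolded = solve-∀

d≤h*q : ∀ M P h d → 1 ≤ M → M * M ≤ 2 * h → d < suc M ^ 4 * P → d ≤ h * (32 * (M * M) * P)
d≤h*q M P h d 1≤M M²≤2h d< = begin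
  d                                          ≤⟨ <⇒≤ d< ⟩
  suc M ^ 4 * P                              ≤⟨ *-monoˡ-≤ P (^-monoˡ-≤ 4 (+-monoˡ-≤ M 1≤M)) ⟩
  (M + M) ^ 4 * P                            ≡⟨ cong (_* P) (^4≡square² (M + M)) ⟩
  (M + M) * (M + M) * ((M + M) * (M + M)) * P ≡⟨ expand M P ⟩
  16 * (M * M) * (M * M) * P                 ≤⟨ *-monoˡ-≤ P (*-monoʳ-≤ (16 * (M * M)) M²≤2h) ⟩
  16 * (M * M) * (2 * h) * P                 ≡⟨ regroup M h P ⟩
  h * (32 * (M * M) * P)                     ∎
  where
  open ≤-Reasoning
  expand : ∀ M P → (M + M) * (M + M) * ((M + M) * (M + M)) * P ≡ 16 * (M * M) * (M * M) * P
  expand = solve-∀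
  regroup : ∀ M h P → 16 * (M * M) * (2 * h) * P ≡ h * (32 * (M * M) * P)
  regroup = solve-∀

k²≤37²dlL : ∀ M L l d → 1 ≤ M → 1 ≤ L → 1 ≤ l → M ^ 4 * (L * l) ≤ d →
  ((32 * (M * M) * (L * l) + 2) + (L + 2)) * ((32 * (M * M) * (L * l) + 2) + (L + 2)) ≤ 37 * 37 * d * l * L
k²≤37²dlL M L l d 1≤M 1≤L 1≤l M⁴P≤d = begin
  k * k                                   ≤⟨ *-mono-≤ k≤37M²P k≤37M²P ⟩
  37 * M² * P * (37 * M² * P)             ≡⟨ regroup M P ⟩
  37 * 37 * (M * M * (M * M) * P) * P     ≡⟨ cong (λ t → 37 * 37 * (t * P) * P) (sym (^4≡square² M)) ⟩
  37 * 37 * (M ^ 4 * P) * P               ≤⟨ *-monoˡ-≤ P (*-monoʳ-≤ (37 * 37) M⁴P≤d) ⟩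
  37 * 37 * d * (L * l)                   ≡⟨ swap-logs d L l ⟩
  37 * 37 * d * l * L                     ∎
  where
  open ≤-Reasoning
  M² P k : ℕ
  M² = M * M
  P = L * l
  k = (32 * M² * P + 2) + (L + 2)
  L≤P : L ≤ P
  L≤P = ≤-trans (≤-reflexive (sym (*-identityʳ L))) (*-monoʳ-≤ L 1≤l)
  k≤37M²P : k ≤ 37 * M² * P
  k≤37M²P = begin
    (32 * M² * P + 2) + (L + 2)           ≡⟨ shift (32 * M² * P) L ⟩
    32 * M² * P + (L + 4 * 1)             ≤⟨ +-monoʳ-≤ (32 * M² * P) (+-mono-≤ L≤P (*-monoʳ-≤ 4 (≤-trans 1≤L L≤P))) ⟩
    32 * M² * P + (P + 4 * P)             ≤⟨ +-monoʳ-≤ (32 * M² * P) (≤-trans (≤-reflexive (sym (*-identityˡ (P + 4 * P)))) (*-monoˡ-≤ (P + 4 * P) (*-mono-≤ 1≤M 1≤M))) ⟩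
    32 * M² * P + M² * (P + 4 * P)        ≡⟨ collect M² P ⟩
    37 * M² * P                           ∎
    where
    shift : ∀ a L → (a + 2) + (L + 2) ≡ a + (L + 4 * 1)
    shift = solve-∀
    collect : ∀ M² P → 32 * M² * P + M² * (P + 4 * P) ≡ 37 * M² * P
    collect = solve-∀
  regroup : ∀ M P → 37 * (M * M) * P * (37 * (M * M) * P) ≡ 37 * 37 * (M * M * (M * M) * P) * P
  regroup = solve-∀
  swap-logs : ∀ d L l → 37 * 37 * d * (L * l) ≡ 37 * 37 * d * l * L
  swap-logs = solve-∀

r²≤6²dL : ∀ M L l l′ d → 1 ≤ L → l′ ≤ l → M ^ 4 * (L * l) ≤ d →
  2 * M * M * (L + 2) * (2 * M * M * (L + 2)) * l′ ≤ 6 * 6 * d * L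
r²≤6²dL M L l l′ d 1≤L l′≤l M⁴P≤d = begin
  D * (L + 2) * (D * (L + 2)) * l′        ≤⟨ *-mono-≤ (*-mono-≤ r≤3DL r≤3DL) l′≤l ⟩
  D * (3 * L) * (D * (3 * L)) * l         ≡⟨ regroup M L l ⟩
  6 * 6 * (M * M * (M * M) * (L * l)) * L ≡⟨ cong (λ t → 6 * 6 * (t * (L * l)) * L) (sym (^4≡square² M)) ⟩
  6 * 6 * (M ^ 4 * (L * l)) * L           ≤⟨ *-monoˡ-≤ L (*-monoʳ-≤ (6 * 6) M⁴P≤d) ⟩
  6 * 6 * d * L                           ∎
  where
  open ≤-Reasoning
  D : ℕ
  D = 2 * M * M
  r≤3DL : D * (L + 2) ≤ D * (3 * L)
  r≤3DL = *-monoʳ-≤ D (≤-trans (+-monoʳ-≤ L (*-monoʳ-≤ 2 1≤L)) (≤-reflexive (triple L)))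
    where
    triple : ∀ L → L + 2 * L ≡ 3 * L
    triple = solve-∀
  regroup : ∀ M L l → 2 * M * M * (3 * L) * (2 * M * M * (3 * L)) * l ≡ 6 * 6 * (M * M * (M * M) * (L * l)) * L
  regroup = solve-∀

SampleBound : (c₁ c₂ d n : ℕ) → Set
SampleBound c₁ c₂ d n =
  ∃[ k ] ∃[ r ]
    (k * k ≤ c₁ * c₁ * d * ⌈log₂ d ⌉ * ⌈log₂ n ⌉) ×
    (r * r * ⌊log₂ d ⌋ ≤ c₂ * c₂ * d * ⌈log₂ n ⌉) ×
    ((H : Vec (Point d) n) → Injective _≡_ _≡_ (lookup H) →
     (ans : Point d → Fin n) → IsNNOracle H ans →
     (i : Fin n) →
     3 * n * count (badSample H ans (lookup H i) r) (tuples (2 ^ k) (allPoints d)) ≤ 2 ^ (d * 2 ^ k))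

single-point-bound : ∀ c₁ c₂ d → SampleBound c₁ c₂ d 1
single-point-bound c₁ c₂ d = 0 , 0 , z≤n , z≤n , λ H _ ans _ i →
  subst (λ c → 3 * 1 * c ≤ 2 ^ (d * 1))
        (sym (trans (count-badSample-tuples H ans (lookup H i) 0 1 (allPoints d))
                    (cong (_* 1) (count-none _ (allPoints d) (never-far H ans i)))))
        z≤n
  where
  never-far : (H : Vec (Point d) 1) (ans : Point d → Fin 1) (i : Fin 1) → ∀ y → answerFar H ans (lookup H i) 0 y ≡ false
  never-far H ans i y with ans y | i
  ... | Fin.zero | Fin.zero rewrite hamming-self (lookup H Fin.zero) = refl

many-points-bound : ∀ d n → 2 ≤ d → 2 ≤ n → ⌈log₂ n ⌉ * ⌈log₂ d ⌉ ≤ d → SampleBound 37 6 d n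
many-points-bound d n 2≤d 2≤n P≤d = from-root (⌊⁴√⌋-exists P 1≤P d)
  where
  L l P : ℕ
  L = ⌈log₂ n ⌉
  l = ⌈log₂ d ⌉
  P = L * l
  1≤L : 1 ≤ L
  1≤L = ⌈log₂n⌉≥1 2≤n
  1≤l : 1 ≤ l
  1≤l = ⌈log₂n⌉≥1 2≤d
  1≤P : 1 ≤ P
  1≤P = *-mono-≤ 1≤L 1≤l
  from-root : ∃[ M ] (M ^ 4 * P ≤ d × d < suc M ^ 4 * P) → SampleBound 37 6 d n
  from-root (zero  , _      , d<P) = contradiction P≤d (<⇒≱ (subst (d <_) (+-identityʳ P) d<P))
  from-root (suc m , M⁴P≤d , d<) =
    k , 2 * M * M * (L + 2) ,
    k²≤37²dlL M L l d (s≤s z≤n) 1≤L 1≤l M⁴P≤d ,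
    r²≤6²dL M L l ⌊log₂ d ⌋ d 1≤L (⌊log₂n⌋≤⌈log₂n⌉ d) M⁴P≤d ,
    λ H _ ans nn i → NearestAnswer.bad-samples-rare m H ans nn i L (n≤2^⌈log₂n⌉ n) q h
                       (d≤h*q M P h d (s≤s z≤n) (n≤2⌈n/2⌉ (M * M)) d<) (2⌈n/2⌉≤1+n (M * M))
    where
    -- M = ⌊(d / P)^(1/4)⌋ balances k ≈ 32 M² P against r ≈ 2 M² L.
    M h q k : ℕ
    M = suc m
    h = ⌈ M * M /2⌉
    q = 32 * (M * M) * P
    k = (q + 2) + (L + 2)

mainTheorem2 : ∃[ c₁ ] ∃[ c₂ ] ∃[ K ] ∃[ d₀ ]
    ((d : ℕ) → d ≥ d₀ → (n : ℕ) → 1 ≤ n →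
    suc K * ⌈log₂ n ⌉ * ⌈log₂ d ⌉ ≤ d →
    ∃[ k ] ∃[ r ]
    (k * k ≤ c₁ * c₁ * d * ⌈log₂ d ⌉ * ⌈log₂ n ⌉) ×
    (r * r * ⌊log₂ d ⌋ ≤ c₂ * c₂ * d * ⌈log₂ n ⌉) ×
    ((H : Vec (Point d) n) → Injective _≡_ _≡_ (lookup H) →
    (ans : Point d → Fin n) → IsNNOracle H ans →
    (i : Fin n) →
    3 * n * count (badSample H ans (lookup H i) r) (tuples (2 ^ k) (allPoints d))
    ≤ 2 ^ (d * 2 ^ k)))
mainTheorem2 = 37 , 6 , 0 , 2 , bound
  where
  bound : (d : ℕ) → d ≥ 2 → (n : ℕ) → 1 ≤ n → 1 * ⌈log₂ n ⌉ * ⌈log₂ d ⌉ ≤ d → SampleBound 37 6 d n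
  bound d _   1                 _ _   = single-point-bound 37 6 d  -- ⌈log₂ 1⌉ = 0 forces r = 0
  bound d 2≤d n@(suc (suc _)) _ P≤d =
    many-points-bound d n 2≤d (s≤s (s≤s z≤n)) (subst (λ L → L * ⌈log₂ d ⌉ ≤ d) (+-identityʳ ⌈log₂ n ⌉) P≤d)
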